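{- Let $u,v\in\mathcal{M}$ have the same number of $D$'s and the same number of $U$'s. Then $\phi(u)=\phi(v)$ if and only if the Ferrers boards $B_u$ and $B_v$ are rook-equivalent. (Consequently, rook-equivalence of $B_u,B_v$ is equivalent to each of: $u\overset{\mathrm{bal}}{\sim}v$; $u\overset{\mathrm{flip}}{\sim}v$; $u,v$ have the same final height and $H(u,z)=H(v,z)$; the same with $H_{NE}$; the same with $H_{SE}$; $\phi(u),\phi(v)$ act equally on $\Bbbk[x]$.)
   Context: $\Bbbk$ is a field of characteristic $0$; $\mathcal{M}$ is the free monoid on letters $D,U$; $\mathcal{W}=\Bbbk\langle D,U\mid DU-UD=1\rangle$ acting on $\Bbbk[x]$ by $D=d/dx$, $U=$ multiplication by $x$; $\phi:\mathcal{M}\to\mathcal{W}$ the monoid morphism $D\mapsto D,U\mapsto U$. For $w=w_1\cdots w_N$, $h_i=\#U-\#D$ in $w_1\cdots w_i$; final height $h_N$; $H(w,z)=\sum_{i=0}^Nz^{h_i}$, $H_{NE}(w,z)=\sum_{i<N,w_{i+1}=U}z^{h_i}$, $H_{SE}(w,z)=\sum_{i<N,w_{i+1}=D}z^{h_i}$. Balanced word: equally many $D$'s and $U$'s; $\omega$: anti-morphism of $\mathcal{M}$ swapping $U,D$; $\overset{\mathrm{bal}}{\sim}$: equivalence generated by $pyxq\leftrightarrow pxyq$ ($x,y$ balanced); $\overset{\mathrm{flip}}{\sim}$: equivalence generated by $p\omega(x)q\leftrightarrow pxq$ ($x$ balanced). A cell is a pair $(i,j)$ of positive integers, a board is a finite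 set of cells; a rook placement of $B$ is a subset of $B$ with no two cells sharing a first coordinate or a second coordinate; $r_k(B)$ is the number of $k$-element rook placements; boards $B,C$ are rook-equivalent if $r_k(B)=r_k(C)$ for all $k\ge0$. If $w$ contains $m$ letters $U$ and $d_j$ denotes the number of $D$'s preceding the $j$-th $U$ of $w$, then $B_w=\{(j,i):1\le j\le m,\ 1\le i\le d_j\}$. -}

module Defs where

open import Level using (Level; _⊔_)
open import Data.Nat as ℕ using (ℕ; zero; suc)
open import Data.Product using (_×_; _,_; Σ; ∃-syntax)
open import Data.List using (List; []; _∷_; length; map; concat; filter; upTo)
open import Data.List.Relation.Unary.All using (All)
open import Relation.Binary.PropositionalEquality using (_≡_; _≢_)
open import Relation.Nullary using (¬_; Dec; yes; no)
open import Relation.Nullary.Decidable using (_×-dec_)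
open import Algebra.Bundles using (CommutativeRing)

record Field (c ℓ : Level) : Set (Level.suc (c ⊔ ℓ)) where
  field
    commutativeRing : CommutativeRing c ℓ
  open CommutativeRing commutativeRing public
  field
    1≉0     : ¬ (1# ≈ 0#)
    inverse : ∀ x → ¬ (x ≈ 0#) → Σ Carrier (λ y → (x * y) ≈ 1#)

module _ {c ℓ} (K : Field c ℓ) where
  open Field K

  natToField : ℕ → Carrier
  natToField zero    = 0#
  natToField (suc n) = 1# + natToField n

  CharacteristicZero : Set ℓ
  CharacteristicZero = ∀ n → ¬ (natToField (suc n) ≈ 0#)

data Letter : Set where
  D U : Letter

Word : Set
Word = List Letter

countD : Word → ℕ
countD []       = 0
countD (D ∷ w)  = suc (countD w)
countD (U ∷ w)  = countD w

countU : Word → ℕ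
countU []       = 0
countU (D ∷ w)  = countU w
countU (U ∷ w)  = suc (countU w)

-- The Weyl algebra W = K⟨D,U | DU - UD = 1⟩, as the K-algebra presented
-- by generators and relations: terms of the free (noncommutative,
-- unital, associative) K-algebra on D, U, modulo the least congruence
-- containing the K-algebra axioms and the relation DU = UD + 1.

module Weyl {c ℓ} (K : Field c ℓ) where
  open Field K using (_≈_; _+_; _*_; -_; 0#; 1#) renaming (Carrier to k)

  infixl 6 _⊕_
  infixl 7 _⊗_

  data Term : Set c where
    cst  : k → Term
    gD   : Term
    gU   : Term
    _⊕_  : Term → Term → Term
    _⊗_  : Term → Term → Term

  infix 4 _≈W_

  data _≈W_ : Term → Term → Set (c ⊔ ℓ) where
    reflW  : ∀ {s} → s ≈W s
    symW   : ∀ {s t} → s ≈W t → t ≈W s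
    transW : ∀ {s t r} → s ≈W t → t ≈W r → s ≈W r
    ⊕-cong : ∀ {s s' t t'} → s ≈W s' → t ≈W t' → s ⊕ t ≈W s' ⊕ t'
    ⊗-cong : ∀ {s s' t t'} → s ≈W s' → t ≈W t' → s ⊗ t ≈W s' ⊗ t'
    ⊕-assoc : ∀ s t r → (s ⊕ t) ⊕ r ≈W s ⊕ (t ⊕ r)
    ⊕-comm  : ∀ s t → s ⊕ t ≈W t ⊕ s
    ⊕-idˡ   : ∀ s → cst 0# ⊕ s ≈W s
    ⊕-invʳ  : ∀ s → s ⊕ (cst (- 1#) ⊗ s) ≈W cst 0#
    ⊗-assoc : ∀ s t r → (s ⊗ t) ⊗ r ≈W s ⊗ (t ⊗ r)
    ⊗-idˡ   : ∀ s → cst 1# ⊗ s ≈W s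
    ⊗-idʳ   : ∀ s → s ⊗ cst 1# ≈W s
    distribˡ : ∀ s t r → s ⊗ (t ⊕ r) ≈W (s ⊗ t) ⊕ (s ⊗ r)
    distribʳ : ∀ s t r → (t ⊕ r) ⊗ s ≈W (t ⊗ s) ⊕ (r ⊗ s)
    -- the scalars: a central copy of K (ring homomorphism K → W)
    cst-cong : ∀ {a b} → a ≈ b → cst a ≈W cst b
    cst-+    : ∀ a b → cst (a + b) ≈W cst a ⊕ cst b
    cst-*    : ∀ a b → cst (a * b) ≈W cst a ⊗ cst b
    cst-central : ∀ a s → cst a ⊗ s ≈W s ⊗ cst a
    weyl : gD ⊗ gU ≈W (gU ⊗ gD) ⊕ cst 1#

  letter : Letter → Term
  letter D = gD
  letter U = gU

  φ : Word → Term
  φ []      = cst 1#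
  φ (x ∷ w) = letter x ⊗ φ w

Cell : Set
Cell = ℕ × ℕ

Board : Set
Board = List Cell   -- a finite set of cells, listed without repetition

subsets : ∀ {a} {A : Set a} → List A → List (List A)
subsets []       = [] ∷ []
subsets (x ∷ xs) = let r = subsets xs in r Data.List.++ map (x ∷_) r

NonAttacking : Cell → Cell → Set
NonAttacking (i , j) (i' , j') = (i ≢ i') × (j ≢ j')

data IsRookPlacement : List Cell → Set where
  []  : IsRookPlacement []
  _∷_ : ∀ {c cs} → All (NonAttacking c) cs → IsRookPlacement cs →
        IsRookPlacement (c ∷ cs)

nonAttacking? : ∀ c c' → Dec (NonAttacking c c')
nonAttacking? (i , j) (i' , j') with i ℕ.≟ i' | j ℕ.≟ j'
... | yes p | _     = no (λ q → Data.Product.proj₁ q p)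
... | no p  | yes q = no (λ r → Data.Product.proj₂ r q)
... | no p  | no q  = yes (p , q)

isRookPlacement? : ∀ cs → Dec (IsRookPlacement cs)
isRookPlacement? [] = yes []
isRookPlacement? (c ∷ cs)
  with Data.List.Relation.Unary.All.all? (nonAttacking? c) cs | isRookPlacement? cs
... | yes p | yes q = yes (p ∷ q)
... | no p  | _     = no (λ { (p' ∷ _) → p p' })
... | yes _ | no q  = no (λ { (_ ∷ q') → q q' })

isKRookPlacement? : ∀ (k : ℕ) cs → Dec (length cs ≡ k × IsRookPlacement cs)
isKRookPlacement? k cs = (length cs ℕ.≟ k) ×-dec isRookPlacement? cs

rookNumber : ℕ → Board → ℕ
rookNumber k B = length (filter (isKRookPlacement? k) (subsets B))

RookEquivalent : Board → Board → Set
RookEquivalent B C = ∀ k → rookNumber k B ≡ rookNumber k C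

-- d_j for j = 1..m : number of D's preceding the j-th U of w
-- (argument n = number of D's read so far)
dsFrom : ℕ → Word → List ℕ
dsFrom n []      = []
dsFrom n (D ∷ w) = dsFrom (suc n) w
dsFrom n (U ∷ w) = n ∷ dsFrom n w

ds : Word → List ℕ
ds = dsFrom 0

cellsFrom : ℕ → List ℕ → Board
cellsFrom j []       = []
cellsFrom j (d ∷ dl) = map (λ i → (j , suc i)) (upTo d) Data.List.++ cellsFrom (suc j) dl

-- B_w = {(j,i) : 1 ≤ j ≤ m, 1 ≤ i ≤ d_j}
ferrersBoard : Word → Board
ferrersBoard w = cellsFrom 1 (ds w)

{-# OPTIONS --safe #-}
-- Normal ordering writes φ(w) = Σ c_w(a,b) U^a D^b, where the natural numbers c_w(a,b) obey the
-- recurrence coming from D U^a D^b = U^a D^(b+1) + a U^(a-1) D^b.  Over a field of characteristic 0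
-- the array c_w is an invariant of φ(w): left multiplication by W on coefficient arrays respects the
-- defining relations, and φ(w) applied to the array of 1 is c_w.  Conversely φ(w) equals its normal
-- form, so the array determines φ(w).
-- On the board side, a leading U adds an empty row to B_w and a leading D adds a column of full
-- height m = #U, so r_{k+1}(B_Dw) = r_{k+1}(B_w) + (m - k) r_k(B_w).  This is the recurrence of c_w
-- along the diagonal a + k = #U, b + k = #D, whence c_w(a,b) = r_k(B_w) there; off the diagonal
-- c_w vanishes.  With #U and #D fixed, equal arrays are thus the same as equal rook numbers.
module Submission where

open import Defs
open import Level using (Level)
open import Data.Product using (_×_)
open import Function.Bundles using (_⇔_; mk⇔)
open import Relation.Binary.PropositionalEquality using (_≡_)
open import Algebra.Bundles using (CommutativeMonoid)

module RookNumbers where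

  open import Data.Empty using (⊥; ⊥-elim)
  open import Data.Nat using (ℕ; zero; suc; _+_; _*_; _<_; _≤_; _∸_; _≤?_; _≟_; s≤s; z≤n)
  open import Data.Nat.Properties
  open import Data.Nat.ListAction using (sum)
  open import Data.Nat.Tactic.RingSolver using (solve-∀)
  open import Algebra.Properties.CommutativeSemigroup +-commutativeSemigroup using (x∙yz≈y∙xz)
  open import Data.Product using (_,_; proj₁; proj₂)
  open import Data.Sum using (inj₁; inj₂)
  open import Data.List using (List; []; _∷_; length; map; filter; upTo; _++_)
  open import Data.List.Properties
    using (filter-++; filter-≐; filter-none; length-++; map-++; map-∘; map-cong; map-upTo; map-applyUpTo)
  open import Data.List.Relation.Unary.All as All using (All; []; _∷_; all?)
  open import Data.List.Relation.Unary.All.Properties using (map⁺; ++⁺)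
  open import Function using (_∘_)
  open import Function.Bundles using (Equivalence)
  open import Relation.Binary.PropositionalEquality
  open import Relation.Nullary using (¬_; Dec; yes; no; contradiction)
  open import Relation.Nullary.Decidable using (_×-dec_)
  open import Relation.Unary using (Decidable)

  module _ {A : Set} {P : A → Set} (P? : Decidable P) where

    #filter : List A → ℕ
    #filter xs = length (filter P? xs)

    #filter-++ : ∀ xs ys → #filter (xs ++ ys) ≡ #filter xs + #filter ys
    #filter-++ xs ys = trans (cong length (filter-++ P? xs ys)) (length-++ (filter P? xs))

    #filter-none : ∀ xs → (∀ x → ¬ P x) → #filter xs ≡ 0
    #filter-none xs ¬P = cong length (filter-none P? (All.universal ¬P xs))

  #filter-map : ∀ {A B : Set} {P : B → Set} (P? : Decidable P) (f : A → B) xs →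
    #filter P? (map f xs) ≡ #filter (P? ∘ f) xs
  #filter-map P? f [] = refl
  #filter-map P? f (x ∷ xs) with P? (f x)
  ... | yes _ = cong suc (#filter-map P? f xs)
  ... | no _  = #filter-map P? f xs

  #filter-≐ : ∀ {A : Set} {P Q : A → Set} (P? : Decidable P) (Q? : Decidable Q) → (∀ x → P x ⇔ Q x) →
    ∀ xs → #filter P? xs ≡ #filter Q? xs
  #filter-≐ P? Q? P⇔Q xs =
    cong length (filter-≐ P? Q? ((λ {x} → Equivalence.to (P⇔Q x)) , (λ {x} → Equivalence.from (P⇔Q x))) xs)

  #filter-subsets-∷ : ∀ {A : Set} {P : List A → Set} (P? : Decidable P) x xs →
    #filter P? (subsets (x ∷ xs)) ≡ #filter P? (subsets xs) + #filter (P? ∘ (x ∷_)) (subsets xs)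
  #filter-subsets-∷ P? x xs =
    trans (#filter-++ P? (subsets xs) _) (cong (#filter P? (subsets xs) +_) (#filter-map P? (x ∷_) (subsets xs)))

  sum-map-linear : ∀ {A : Set} (f g h : A → ℕ) a b {R} → All (λ y → f y + a * g y ≡ h y + b * g y) R →
    sum (map f R) + a * sum (map g R) ≡ sum (map h R) + b * sum (map g R)
  sum-map-linear f g h a b []       = trans (cong (0 +_) (*-zeroʳ a)) (sym (*-zeroʳ b))
  sum-map-linear f g h a b {y ∷ R} (e ∷ es) = begin
    (f y + F) + a * (g y + G)      ≡⟨ regroup (f y) F a (g y) G ⟩
    (f y + a * g y) + (F + a * G)  ≡⟨ cong₂ _+_ e (sum-map-linear f g h a b es) ⟩
    (h y + b * g y) + (H + b * G)  ≡⟨ sym (regroup (h y) H b (g y) G) ⟩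
    (h y + H) + b * (g y + G)      ∎
    where
    open ≡-Reasoning
    F = sum (map f R)
    G = sum (map g R)
    H = sum (map h R)
    regroup : ∀ p P c q Q → (p + P) + c * (q + Q) ≡ (p + c * q) + (P + c * Q)
    regroup = solve-∀

  Compatible : Cell → List Cell → Set
  Compatible x F = All (NonAttacking x) F

  compatible? : ∀ x F → Dec (Compatible x F)
  compatible? x F = all? (nonAttacking? x) F

  when : {P : Set} → Dec P → ℕ → ℕ
  when (yes _) n = n
  when (no _)  _ = 0

  when-cong : ∀ {P Q : Set} (p : Dec P) (q : Dec Q) → P ⇔ Q → ∀ {m n} → m ≡ n → when p m ≡ when q n
  when-cong (yes _) (yes _) _   m≡n = m≡n
  when-cong (yes p) (no ¬q) P⇔Q _   = ⊥-elim (¬q (Equivalence.to P⇔Q p))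
  when-cong (no ¬p) (yes q) P⇔Q _   = ⊥-elim (¬p (Equivalence.from P⇔Q q))
  when-cong (no _)  (no _)  _   _   = refl

  when-no : ∀ {P : Set} (p : Dec P) → ¬ P → ∀ n → when p n ≡ 0
  when-no (yes p) ¬p n = ⊥-elim (¬p p)
  when-no (no _)  _  n = refl

  when-yes : ∀ {P : Set} (p : Dec P) → P → ∀ n → when p n ≡ n
  when-yes (yes _) _ n = refl
  when-yes (no ¬p) p n = contradiction p ¬p

  when-linear : ∀ {P : Set} (p : Dec P) {a b c x y} → a + x * b ≡ c + y * b →
    when p a + x * when p b ≡ when p c + y * when p b
  when-linear (yes _) e = e
  when-linear (no _) {x = x} {y} _ = trans (*-zeroʳ x) (sym (*-zeroʳ y))

  -- the number of k-rook placements S ⊆ L none of whose cells attacks a cell of F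
  #placements : List Cell → ℕ → List Cell → ℕ
  #placements F zero    L       = 1
  #placements F (suc k) []      = 0
  #placements F (suc k) (x ∷ L) =
    #placements F (suc k) L + when (compatible? x F) (#placements (x ∷ F) k L)

  IsPlacement : List Cell → ℕ → List Cell → Set
  IsPlacement F k S = length S ≡ k × IsRookPlacement S × All (λ c → Compatible c F) S

  placement? : ∀ F k → Decidable (IsPlacement F k)
  placement? F k S = (length S ≟ k) ×-dec isRookPlacement? S ×-dec all? (λ c → compatible? c F) S

  nonAttacking-sym : ∀ c d → NonAttacking c d → NonAttacking d c
  nonAttacking-sym _ _ (i≢i′ , j≢j′) = i≢i′ ∘ sym , j≢j′ ∘ sym

  isPlacement-∷ : ∀ F k x S → IsPlacement F (suc k) (x ∷ S) ⇔ (Compatible x F × IsPlacement (x ∷ F) k S)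
  isPlacement-∷ F k x S = mk⇔
    (λ { (len , x-S ∷ S-rook , x-F ∷ S-F) →
         x-F , suc-injective len , S-rook ,
         All.zipWith (λ (x-c , c-F) → nonAttacking-sym x _ x-c ∷ c-F) (x-S , S-F) })
    (λ { (x-F , len , S-rook , S-xF) →
         cong suc len , All.map (λ { (c-x ∷ _) → nonAttacking-sym _ x c-x }) S-xF ∷ S-rook ,
         x-F ∷ All.map All.tail S-xF })

  #placements-count : ∀ F k L → #filter (placement? F k) (subsets L) ≡ #placements F k L
  #placements-count F zero    []      = refl
  #placements-count F (suc k) []      = refl
  #placements-count F zero    (x ∷ L) =
    trans (#filter-subsets-∷ (placement? F 0) x L)
          (cong₂ _+_ (#placements-count F 0 L) (#filter-none _ (subsets L) λ { _ (() , _) }))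
  #placements-count F (suc k) (x ∷ L) with compatible? x F
  ... | yes x-F = trans (#filter-subsets-∷ (placement? F (suc k)) x L)
    (cong₂ _+_ (#placements-count F (suc k) L)
               (trans (#filter-≐ _ (placement? (x ∷ F) k) extend (subsets L)) (#placements-count (x ∷ F) k L)))
    where
    extend : ∀ S → IsPlacement F (suc k) (x ∷ S) ⇔ IsPlacement (x ∷ F) k S
    extend S = mk⇔ (proj₂ ∘ to) (from ∘ (x-F ,_))
      where open Equivalence (isPlacement-∷ F k x S)
  ... | no ¬x-F = trans (#filter-subsets-∷ (placement? F (suc k)) x L)
    (cong₂ _+_ (#placements-count F (suc k) L)
               (#filter-none _ (subsets L) (λ S → ¬x-F ∘ proj₁ ∘ Equivalence.to (isPlacement-∷ F k x S))))

  rookNumber≡#placements : ∀ k B → rookNumber k B ≡ #placements [] k B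
  rookNumber≡#placements k B =
    trans (#filter-≐ (isKRookPlacement? k) (placement? [] k) noConstraint (subsets B)) (#placements-count [] k B)
    where
    noConstraint : ∀ S → (length S ≡ k × IsRookPlacement S) ⇔ IsPlacement [] k S
    noConstraint S = mk⇔ (λ (len , rook) → len , rook , All.universal (λ _ → []) S) (λ (len , rook , _) → len , rook)

  AttackInvariant : (Cell → Cell) → Set
  AttackInvariant g = ∀ c c′ → NonAttacking (g c) (g c′) ⇔ NonAttacking c c′

  compatible-∷ : ∀ {g} → AttackInvariant g → ∀ {c x G F} →
    Compatible (g c) G ⇔ Compatible c F → Compatible (g c) (g x ∷ G) ⇔ Compatible c (x ∷ F)
  compatible-∷ inv {c} {x} c-compat = mk⇔
    (λ { (h ∷ t) → Equivalence.to (inv c x) h ∷ Equivalence.to c-compat t })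
    (λ { (h ∷ t) → Equivalence.from (inv c x) h ∷ Equivalence.from c-compat t })

  compatible-map : ∀ {g} → AttackInvariant g → ∀ c F → Compatible (g c) (map g F) ⇔ Compatible c F
  compatible-map inv c []      = mk⇔ (λ _ → []) (λ _ → [])
  compatible-map inv c (x ∷ F) = compatible-∷ inv (compatible-map inv c F)

  data Relabelling (g : Cell → Cell) (Blocked : Cell → Set) : List Cell → List Cell → Set where
    []       : Relabelling g Blocked [] []
    mapped∷  : ∀ {x L′ L} → Relabelling g Blocked L′ L → Relabelling g Blocked (g x ∷ L′) (x ∷ L)
    blocked∷ : ∀ {y L′ L} → Blocked y → Relabelling g Blocked L′ L → Relabelling g Blocked (y ∷ L′) L

  relabelling-map++ : ∀ {g Blocked L′ L} R → Relabelling g Blocked L′ L →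
    Relabelling g Blocked (map g R ++ L′) (R ++ L)
  relabelling-map++ []      rel = rel
  relabelling-map++ (x ∷ R) rel = mapped∷ (relabelling-map++ R rel)

  relabelling-map : ∀ {g Blocked} L → Relabelling g Blocked (map g L) L
  relabelling-map []      = []
  relabelling-map (x ∷ L) = mapped∷ (relabelling-map L)

  #placements-relabel : ∀ {g Blocked L′ L} → Relabelling g Blocked L′ L → AttackInvariant g → ∀ G F →
    (∀ y → Blocked y → ¬ Compatible y G) → All (λ c → Compatible (g c) G ⇔ Compatible c F) L →
    ∀ k → #placements G k L′ ≡ #placements F k L
  #placements-relabel rel inv G F blocked compat zero = refl
  #placements-relabel [] inv G F blocked compat (suc k) = refl
  #placements-relabel {g} (mapped∷ {x} rel) inv G F blocked (x-compat ∷ compat) (suc k) =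
    cong₂ _+_ (#placements-relabel rel inv G F blocked compat (suc k))
              (when-cong (compatible? (g x) G) (compatible? x F) x-compat
                (#placements-relabel rel inv (g x ∷ G) (x ∷ F) (λ y b → blocked y b ∘ All.tail)
                                     (All.map (compatible-∷ inv) compat) k))
  #placements-relabel (blocked∷ {y} b rel) inv G F blocked compat (suc k) =
    trans (cong₂ _+_ (#placements-relabel rel inv G F blocked compat (suc k))
                     (when-no (compatible? y G) (blocked y b) _))
          (+-identityʳ _)

  shiftRow shiftCol : Cell → Cell
  shiftRow (i , j) = suc i , j
  shiftCol (i , j) = i , suc j

  attackInvariant-shiftRow : AttackInvariant shiftRow
  attackInvariant-shiftRow _ _ = mk⇔ (λ (i≢ , j≢) → i≢ ∘ cong suc , j≢) (λ (i≢ , j≢) → i≢ ∘ suc-injective , j≢)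

  attackInvariant-shiftCol : AttackInvariant shiftCol
  attackInvariant-shiftCol _ _ = mk⇔ (λ (i≢ , j≢) → i≢ , j≢ ∘ cong suc) (λ (i≢ , j≢) → i≢ , j≢ ∘ suc-injective)

  dsFrom-suc : ∀ n w → dsFrom (suc n) w ≡ map suc (dsFrom n w)
  dsFrom-suc n []      = refl
  dsFrom-suc n (D ∷ w) = dsFrom-suc (suc n) w
  dsFrom-suc n (U ∷ w) = cong (suc n ∷_) (dsFrom-suc n w)

  length-dsFrom : ∀ n w → length (dsFrom n w) ≡ countU w
  length-dsFrom n []      = refl
  length-dsFrom n (D ∷ w) = length-dsFrom (suc n) w
  length-dsFrom n (U ∷ w) = cong suc (length-dsFrom n w)

  row : ℕ → ℕ → Board
  row j d = map (λ i → j , suc i) (upTo d)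

  row-suc : ∀ j d → row j (suc d) ≡ (j , 1) ∷ map shiftCol (row j d)
  row-suc j d =
    cong ((j , 1) ∷_) (trans (map-applyUpTo suc _ d) (sym (trans (sym (map-∘ (upTo d))) (map-upTo _ d))))

  cellsFrom-suc : ∀ j ds → cellsFrom (suc j) ds ≡ map shiftRow (cellsFrom j ds)
  cellsFrom-suc j []       = refl
  cellsFrom-suc j (d ∷ ds) =
    trans (cong₂ _++_ (map-∘ (upTo d)) (cellsFrom-suc (suc j) ds)) (sym (map-++ shiftRow (row j d) _))

  row-cells : ∀ j d → All (λ c → proj₁ c ≡ j × 1 ≤ proj₂ c) (row j d)
  row-cells j d = map⁺ (All.universal (λ _ → refl , s≤s z≤n) (upTo d))

  cellsFrom-cells : ∀ j ds → All (λ c → j ≤ proj₁ c × 1 ≤ proj₂ c) (cellsFrom j ds)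
  cellsFrom-cells j []       = []
  cellsFrom-cells j (d ∷ ds) = ++⁺
    (All.map (λ (i≡j , 1≤) → ≤-reflexive (sym i≡j) , 1≤) (row-cells j d))
    (All.map (λ (j<i , 1≤) → ≤-trans (n≤1+n j) j<i , 1≤) (cellsFrom-cells (suc j) ds))

  InFirstColumn : Cell → Set
  InFirstColumn c = proj₂ c ≡ 1

  relabelling-newColumn : ∀ j ds → Relabelling shiftCol InFirstColumn (cellsFrom j (map suc ds)) (cellsFrom j ds)
  relabelling-newColumn j []       = []
  relabelling-newColumn j (d ∷ ds) =
    subst (λ R → Relabelling shiftCol InFirstColumn (R ++ cellsFrom (suc j) (map suc ds)) (cellsFrom j (d ∷ ds)))
          (sym (row-suc j d))
          (blocked∷ refl (relabelling-map++ (row j d) (relabelling-newColumn (suc j) ds)))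

  #placements-occupiedColumn : ∀ {r j} → r < j → ∀ F ds k →
    #placements ((r , 1) ∷ map shiftCol F) k (cellsFrom j (map suc ds)) ≡ #placements F k (cellsFrom j ds)
  #placements-occupiedColumn {r} {j} r<j F ds =
    #placements-relabel (relabelling-newColumn j ds) attackInvariant-shiftCol _ F
      (λ { _ col≡1 (h ∷ _) → proj₂ h col≡1 }) (All.map shifted (cellsFrom-cells j ds))
    where
    shifted : ∀ {c} → j ≤ proj₁ c × 1 ≤ proj₂ c →
      Compatible (shiftCol c) ((r , 1) ∷ map shiftCol F) ⇔ Compatible c F
    shifted {c} (j≤i , 1≤) = mk⇔ (λ { (_ ∷ t) → to t })
      (λ c-F → ((λ i≡r → <⇒≢ (<-≤-trans r<j j≤i) (sym i≡r)) , (λ 1+≡1 → <⇒≢ (s≤s 1≤) (sym 1+≡1))) ∷ from c-F)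
      where open Equivalence (compatible-map attackInvariant-shiftCol c F)

  #placements-skip : ∀ G R L → All (λ c → ¬ Compatible c G) R → ∀ k → #placements G k (R ++ L) ≡ #placements G k L
  #placements-skip G R       L blocked zero    = refl
  #placements-skip G []      L blocked (suc k) = refl
  #placements-skip G (x ∷ R) L (x-blocked ∷ blocked) (suc k) =
    trans (cong₂ _+_ (#placements-skip G R L blocked (suc k)) (when-no (compatible? x G) x-blocked _)) (+-identityʳ _)

  #placements-row++ : ∀ G j R L → All (λ c → proj₁ c ≡ j) R → ∀ k →
    #placements G (suc k) (R ++ L) ≡
    #placements G (suc k) L + sum (map (λ x → when (compatible? x G) (#placements (x ∷ G) k L)) R)
  #placements-row++ G j []      L _ k = sym (+-identityʳ _)
  #placements-row++ G j (x ∷ R) L (x-in-j ∷ R-in-j) k = begin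
    #placements G (suc k) (R ++ L) + when (compatible? x G) (#placements (x ∷ G) k (R ++ L))
      ≡⟨ cong₂ _+_ (#placements-row++ G j R L R-in-j k)
                   (cong (when (compatible? x G)) (#placements-skip (x ∷ G) R L sameRow k)) ⟩
    #placements G (suc k) L + Σ + when (compatible? x G) (#placements (x ∷ G) k L)
      ≡⟨ trans (+-assoc (#placements G (suc k) L) Σ _) (cong (#placements G (suc k) L +_) (+-comm Σ _)) ⟩
    #placements G (suc k) L + (when (compatible? x G) (#placements (x ∷ G) k L) + Σ) ∎
    where
    open ≡-Reasoning
    Σ = sum (map (λ y → when (compatible? y G) (#placements (y ∷ G) k L)) R)
    sameRow : All (λ c → ¬ Compatible c (x ∷ G)) R
    sameRow = All.map (λ { c-in-j (h ∷ _) → proj₁ h (trans c-in-j (sym x-in-j)) }) R-in-j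

  #rows : List Cell → ℕ → ℕ → List ℕ → ℕ
  #rows F k j ds = #placements F k (cellsFrom j ds)

  -- the same rows, each lengthened by a new first column
  #rows⁺ : List Cell → ℕ → ℕ → List ℕ → ℕ
  #rows⁺ F k j ds = #placements (map shiftCol F) k (cellsFrom j (map suc ds))

  BeforeRow : ℕ → List Cell → Set
  BeforeRow j F = All (λ c → proj₁ c < j × 1 ≤ proj₂ c) F

  beforeRow-suc : ∀ {j F} → BeforeRow j F → BeforeRow (suc j) F
  beforeRow-suc = All.map (λ (i<j , 1≤) → m<n⇒m<1+n i<j , 1≤)

  compatible-newColumn : ∀ j F → BeforeRow j F → Compatible (j , 1) (map shiftCol F)
  compatible-newColumn j []      []                  = []
  compatible-newColumn j (_ ∷ F) ((i<j , 1≤) ∷ F<j) =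
    ((λ j≡i → <⇒≢ i<j (sym j≡i)) , (λ 1≡ → <⇒≢ (s≤s 1≤) 1≡)) ∷ compatible-newColumn j F F<j

  #rows-∷ : ∀ F k j d ds → #rows F (suc k) j (d ∷ ds) ≡
    #rows F (suc k) (suc j) ds + sum (map (λ y → when (compatible? y F) (#rows (y ∷ F) k (suc j) ds)) (row j d))
  #rows-∷ F k j d ds = #placements-row++ F j (row j d) _ (All.map proj₁ (row-cells j d)) k

  -- A rook on the new cell (j , 1) blocks the rest of row j and the whole new column.
  #rows⁺-∷ : ∀ F k j d ds → BeforeRow j F → #rows⁺ F (suc k) j (d ∷ ds) ≡
    (#rows⁺ F (suc k) (suc j) ds + sum (map (λ y → when (compatible? y F) (#rows⁺ (y ∷ F) k (suc j) ds)) (row j d)))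
    + #rows F k (suc j) ds
  #rows⁺-∷ F k j d ds F<j = begin
    #placements sF (suc k) (row j (suc d) ++ rest)
      ≡⟨ cong (λ R → #placements sF (suc k) (R ++ rest)) (row-suc j d) ⟩
    #placements sF (suc k) (sR ++ rest) + when (compatible? (j , 1) sF) (#placements ((j , 1) ∷ sF) k (sR ++ rest))
      ≡⟨ cong₂ _+_ shiftedRow newColumn ⟩
    (#rows⁺ F (suc k) (suc j) ds + sum (map (λ y → when (compatible? y F) (#rows⁺ (y ∷ F) k (suc j) ds)) (row j d)))
    + #rows F k (suc j) ds ∎
    where
    open ≡-Reasoning
    sF = map shiftCol F
    sR = map shiftCol (row j d)
    rest = cellsFrom (suc j) (map suc ds)
    sR-in-j : All (λ c → proj₁ c ≡ j) sR
    sR-in-j = map⁺ {P = λ c → proj₁ c ≡ j} (All.map proj₁ (row-cells j d))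
    unshift : ∀ y → when (compatible? (shiftCol y) sF) (#rows⁺ (y ∷ F) k (suc j) ds)
                  ≡ when (compatible? y F) (#rows⁺ (y ∷ F) k (suc j) ds)
    unshift y =
      when-cong (compatible? (shiftCol y) sF) (compatible? y F) (compatible-map attackInvariant-shiftCol y F) refl
    shiftedRow : #placements sF (suc k) (sR ++ rest) ≡
      #rows⁺ F (suc k) (suc j) ds + sum (map (λ y → when (compatible? y F) (#rows⁺ (y ∷ F) k (suc j) ds)) (row j d))
    shiftedRow = trans (#placements-row++ sF j sR rest sR-in-j k)
      (cong (#rows⁺ F (suc k) (suc j) ds +_) (cong sum (trans (sym (map-∘ (row j d))) (map-cong unshift (row j d)))))
    newColumn : when (compatible? (j , 1) sF) (#placements ((j , 1) ∷ sF) k (sR ++ rest)) ≡ #rows F k (suc j) ds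
    newColumn = begin
      when (compatible? (j , 1) sF) (#placements ((j , 1) ∷ sF) k (sR ++ rest))
        ≡⟨ when-yes (compatible? (j , 1) sF) (compatible-newColumn j F F<j) _ ⟩
      #placements ((j , 1) ∷ sF) k (sR ++ rest)
        ≡⟨ #placements-skip _ sR rest (All.map (λ { i≡j (h ∷ _) → proj₁ h i≡j }) sR-in-j) k ⟩
      #placements ((j , 1) ∷ sF) k rest
        ≡⟨ #placements-occupiedColumn (n<1+n j) F ds k ⟩
      #rows F k (suc j) ds ∎

  -- r_{k+1}(B⁺) = r_{k+1}(B) + (m - k) r_k(B) for B⁺ = B plus a full first column of height m,
  -- rearranged to avoid truncated subtraction; the rooks F already placed in earlier rows load the
  -- induction over rows.
  column-recurrence : ∀ ds j F → BeforeRow j F → ∀ k →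
    #rows⁺ F (suc k) j ds + k * #rows F k j ds ≡ #rows F (suc k) j ds + length ds * #rows F k j ds
  column-recurrence []       j F F<j zero    = refl
  column-recurrence []       j F F<j (suc k) = *-zeroʳ (suc k)
  column-recurrence (d ∷ ds) j F F<j zero    = begin
    #rows⁺ F 1 j (d ∷ ds) + 0                        ≡⟨ cong (_+ 0) (#rows⁺-∷ F 0 j d ds F<j) ⟩
    (#rows⁺ F 1 (suc j) ds + S) + 1 + 0              ≡⟨ cong (λ a → (a + S) + 1 + 0) IH ⟩
    (#rows F 1 (suc j) ds + length ds + S) + 1 + 0   ≡⟨ regroup (#rows F 1 (suc j) ds) S (length ds) ⟩
    (#rows F 1 (suc j) ds + S) + suc (length ds) * 1 ≡⟨ cong (_+ suc (length ds) * 1) (sym (#rows-∷ F 0 j d ds)) ⟩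
    #rows F 1 j (d ∷ ds) + suc (length ds) * 1       ∎
    where
    open ≡-Reasoning
    S = sum (map (λ y → when (compatible? y F) 1) (row j d))
    IH : #rows⁺ F 1 (suc j) ds ≡ #rows F 1 (suc j) ds + length ds
    IH = begin
      #rows⁺ F 1 (suc j) ds                 ≡⟨ +-identityʳ _ ⟨
      #rows⁺ F 1 (suc j) ds + 0             ≡⟨ column-recurrence ds (suc j) F (beforeRow-suc F<j) 0 ⟩
      #rows F 1 (suc j) ds + length ds * 1  ≡⟨ cong (#rows F 1 (suc j) ds +_) (*-identityʳ (length ds)) ⟩
      #rows F 1 (suc j) ds + length ds      ∎
    regroup : ∀ p s l → (p + l + s) + 1 + 0 ≡ (p + s) + suc l * 1
    regroup = solve-∀
  column-recurrence (d ∷ ds) j F F<j (suc k) = begin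
    #rows⁺ F (2 + k) j (d ∷ ds) + suc k * #rows F (suc k) j (d ∷ ds)
      ≡⟨ cong₂ (λ x y → x + suc k * y) (#rows⁺-∷ F (suc k) j d ds F<j) (#rows-∷ F k j d ds) ⟩
    ((A₂ + Σ⁺) + P₁) + suc k * (P₁ + Σ₀)
      ≡⟨ regroup A₂ Σ⁺ P₁ k Σ₀ P₂ (length ds) Σ₁
                 (column-recurrence ds (suc j) F (beforeRow-suc F<j) (suc k))
                 (sum-map-linear a⁺ p₀ p₁ k (length ds) (All.map (step _) (row-cells j d))) ⟩
    (P₂ + Σ₁) + suc (length ds) * (P₁ + Σ₀)
      ≡⟨ cong₂ (λ x y → x + suc (length ds) * y) (sym (#rows-∷ F (suc k) j d ds)) (sym (#rows-∷ F k j d ds)) ⟩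
    #rows F (2 + k) j (d ∷ ds) + suc (length ds) * #rows F (suc k) j (d ∷ ds) ∎
    where
    open ≡-Reasoning
    A₂ = #rows⁺ F (2 + k) (suc j) ds
    P₂ = #rows F (2 + k) (suc j) ds
    P₁ = #rows F (suc k) (suc j) ds
    a⁺ p₁ p₀ : Cell → ℕ
    a⁺ y = when (compatible? y F) (#rows⁺ (y ∷ F) (suc k) (suc j) ds)
    p₁ y = when (compatible? y F) (#rows (y ∷ F) (suc k) (suc j) ds)
    p₀ y = when (compatible? y F) (#rows (y ∷ F) k (suc j) ds)
    Σ⁺ = sum (map a⁺ (row j d))
    Σ₁ = sum (map p₁ (row j d))
    Σ₀ = sum (map p₀ (row j d))
    step : ∀ y → proj₁ y ≡ j × 1 ≤ proj₂ y → a⁺ y + k * p₀ y ≡ p₁ y + length ds * p₀ y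
    step y (y-in-j , 1≤) = when-linear (compatible? y F) {x = k} {length ds}
      (column-recurrence ds (suc j) (y ∷ F) ((≤-reflexive (cong suc y-in-j) , 1≤) ∷ beforeRow-suc F<j) k)
    regroup : ∀ a s p k t q l u → a + suc k * p ≡ q + l * p → s + k * t ≡ u + l * t →
      ((a + s) + p) + suc k * (p + t) ≡ (q + u) + suc l * (p + t)
    regroup a s p k t q l u e₁ e₂ =
      trans (split a s p k t) (trans (cong₂ (λ x y → x + y + (p + t)) e₁ e₂) (merge q l p u t))
      where
      split : ∀ a s p k t → ((a + s) + p) + suc k * (p + t) ≡ (a + suc k * p) + (s + k * t) + (p + t)
      split = solve-∀
      merge : ∀ q l p u t → (q + l * p) + (u + l * t) + (p + t) ≡ (q + u) + suc l * (p + t)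
      merge = solve-∀

  rooks : Word → ℕ → ℕ
  rooks w k = #placements [] k (ferrersBoard w)

  rooks-U : ∀ w k → rooks (U ∷ w) k ≡ rooks w k
  rooks-U w k = trans (cong (#placements [] k) (cellsFrom-suc 1 (ds w)))
    (#placements-relabel (relabelling-map {Blocked = λ _ → ⊥} _) attackInvariant-shiftRow [] [] (λ _ ())
                         (All.universal (λ _ → mk⇔ (λ _ → []) (λ _ → [])) _) k)

  rooks-D : ∀ w k → rooks (D ∷ w) (suc k) + k * rooks w k ≡ rooks w (suc k) + countU w * rooks w k
  rooks-D w k = begin
    #placements [] (suc k) (cellsFrom 1 (dsFrom 1 w)) + k * rooks w k
      ≡⟨ cong (λ ds → #placements [] (suc k) (cellsFrom 1 ds) + k * rooks w k) (dsFrom-suc 0 w) ⟩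
    #rows⁺ [] (suc k) 1 (ds w) + k * rooks w k
      ≡⟨ column-recurrence (ds w) 1 [] [] k ⟩
    rooks w (suc k) + length (ds w) * rooks w k
      ≡⟨ cong (λ m → rooks w (suc k) + m * rooks w k) (length-dsFrom 0 w) ⟩
    rooks w (suc k) + countU w * rooks w k ∎
    where open ≡-Reasoning

  rooks-D′ : ∀ w k a → suc a + k ≡ countU w → rooks (D ∷ w) (suc k) ≡ rooks w (suc k) + suc a * rooks w k
  rooks-D′ w k a m≡ = +-cancelʳ-≡ (k * rooks w k) _ _ (begin
    rooks (D ∷ w) (suc k) + k * rooks w k     ≡⟨ rooks-D w k ⟩
    rooks w (suc k) + countU w * rooks w k    ≡⟨ cong (λ m → rooks w (suc k) + m * rooks w k) (sym m≡) ⟩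
    rooks w (suc k) + (suc a + k) * rooks w k ≡⟨ cong (rooks w (suc k) +_) (*-distribʳ-+ (rooks w k) (suc a) k) ⟩
    rooks w (suc k) + (suc a * rooks w k + k * rooks w k) ≡⟨ +-assoc (rooks w (suc k)) _ _ ⟨
    rooks w (suc k) + suc a * rooks w k + k * rooks w k ∎)
    where open ≡-Reasoning

  rooks-D-vanish : ∀ w k → rooks w k ≡ 0 → rooks w (suc k) ≡ 0 → rooks (D ∷ w) (suc k) ≡ 0
  rooks-D-vanish w k r₀ r₁ = m+n≡0⇒m≡0 _ (begin
    rooks (D ∷ w) (suc k) + k * rooks w k   ≡⟨ rooks-D w k ⟩
    rooks w (suc k) + countU w * rooks w k  ≡⟨ cong₂ (λ x y → x + countU w * y) r₁ r₀ ⟩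
    countU w * 0                            ≡⟨ *-zeroʳ (countU w) ⟩
    0                                       ∎)
    where open ≡-Reasoning

  rooks-vanish-U : ∀ w k → countU w < k → rooks w k ≡ 0
  rooks-vanish-U []      (suc k) _ = refl
  rooks-vanish-U (U ∷ w) k       m<k = trans (rooks-U w k) (rooks-vanish-U w k (<-trans (n<1+n _) m<k))
  rooks-vanish-U (D ∷ w) (suc k) m<k with m≤n⇒m<n∨m≡n (≤-pred m<k)
  ... | inj₁ m<k′ = rooks-D-vanish w k (rooks-vanish-U w k m<k′) (rooks-vanish-U w (suc k) m<k)
  ... | inj₂ m≡k  = +-cancelʳ-≡ (k * rooks w k) _ 0
    (trans (rooks-D w k) (cong₂ (λ x m → x + m * rooks w k) (rooks-vanish-U w (suc k) m<k) m≡k))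

  rooks-vanish-D : ∀ w k → countD w < k → rooks w k ≡ 0
  rooks-vanish-D []      (suc k) _ = refl
  rooks-vanish-D (U ∷ w) k       n<k = trans (rooks-U w k) (rooks-vanish-D w k n<k)
  rooks-vanish-D (D ∷ w) (suc k) n<k =
    rooks-D-vanish w k (rooks-vanish-D w k (≤-pred n<k)) (rooks-vanish-D w (suc k) (<-trans (n<1+n _) n<k))

  -- the coefficient of U^a D^b in the normally ordered expansion of φ w,
  -- from D U^a D^b = U^a D^(b+1) + a U^(a-1) D^b
  normalCoeff : Word → ℕ → ℕ → ℕ
  normalCoeff []      zero    zero    = 1
  normalCoeff []      zero    (suc b) = 0
  normalCoeff []      (suc a) b       = 0
  normalCoeff (U ∷ w) zero    b       = 0
  normalCoeff (U ∷ w) (suc a) b       = normalCoeff w a b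
  normalCoeff (D ∷ w) a       zero    = suc a * normalCoeff w (suc a) zero
  normalCoeff (D ∷ w) a       (suc b) = normalCoeff w a b + suc a * normalCoeff w (suc a) (suc b)

  normalCoeff-vanish-U : ∀ w a b → countU w < a → normalCoeff w a b ≡ 0
  normalCoeff-vanish-U []      (suc a) b       _   = refl
  normalCoeff-vanish-U (U ∷ w) (suc a) b       m<a = normalCoeff-vanish-U w a b (≤-pred m<a)
  normalCoeff-vanish-U (D ∷ w) a       zero    m<a =
    trans (cong (suc a *_) (normalCoeff-vanish-U w (suc a) zero (m<n⇒m<1+n m<a))) (*-zeroʳ (suc a))
  normalCoeff-vanish-U (D ∷ w) a       (suc b) m<a =
    trans (cong₂ (λ x y → x + suc a * y) (normalCoeff-vanish-U w a b m<a)
                                         (normalCoeff-vanish-U w (suc a) (suc b) (m<n⇒m<1+n m<a)))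
          (*-zeroʳ (suc a))

  normalCoeff-unbalanced : ∀ w a b → a + countD w ≢ b + countU w → normalCoeff w a b ≡ 0
  normalCoeff-unbalanced []      zero    zero    ≢ = ⊥-elim (≢ refl)
  normalCoeff-unbalanced []      zero    (suc b) ≢ = refl
  normalCoeff-unbalanced []      (suc a) b       ≢ = refl
  normalCoeff-unbalanced (U ∷ w) zero    b       ≢ = refl
  normalCoeff-unbalanced (U ∷ w) (suc a) b       ≢ =
    normalCoeff-unbalanced w a b (λ e → ≢ (trans (cong suc e) (sym (+-suc b (countU w)))))
  normalCoeff-unbalanced (D ∷ w) a       zero    ≢ =
    trans (cong (suc a *_) (normalCoeff-unbalanced w (suc a) zero (λ e → ≢ (trans (+-suc a (countD w)) e))))
          (*-zeroʳ (suc a))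
  normalCoeff-unbalanced (D ∷ w) a       (suc b) ≢ =
    trans (cong₂ (λ x y → x + suc a * y)
                 (normalCoeff-unbalanced w a b (λ e → ≢ (trans (+-suc a (countD w)) (cong suc e))))
                 (normalCoeff-unbalanced w (suc a) (suc b) (λ e → ≢ (trans (+-suc a (countD w)) e))))
          (*-zeroʳ (suc a))

  normalCoeff≡rooks : ∀ w k a b → a + k ≡ countU w → b + k ≡ countD w → normalCoeff w a b ≡ rooks w k
  normalCoeff≡rooks []      zero    zero    zero    _   _   = refl
  normalCoeff≡rooks []      zero    zero    (suc b) _   ()
  normalCoeff≡rooks []      zero    (suc a) b       ()  _
  normalCoeff≡rooks []      (suc k) a       b       a+k≡ _ = ⊥-elim (1+n≢0 (trans (sym (+-suc a k)) a+k≡))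
  normalCoeff≡rooks (U ∷ w) k       zero    b       k≡  _   =
    sym (trans (rooks-U w k) (rooks-vanish-U w k (≤-reflexive (sym k≡))))
  normalCoeff≡rooks (U ∷ w) k       (suc a) b       a+k≡ b+k≡ =
    trans (normalCoeff≡rooks w k a b (suc-injective a+k≡) b+k≡) (sym (rooks-U w k))
  normalCoeff≡rooks (D ∷ w) zero    a       zero    _   ()
  normalCoeff≡rooks (D ∷ w) zero    a       (suc b) a+0≡ b+0≡ = begin
    normalCoeff w a b + suc a * normalCoeff w (suc a) (suc b)
      ≡⟨ cong₂ (λ x y → x + suc a * y)
               (normalCoeff≡rooks w 0 a b a+0≡ (suc-injective b+0≡))
               (normalCoeff-vanish-U w (suc a) (suc b) (s≤s (≤-reflexive (trans (sym a+0≡) (+-identityʳ a))))) ⟩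
    1 + suc a * 0
      ≡⟨ cong suc (*-zeroʳ (suc a)) ⟩
    1 ∎
    where open ≡-Reasoning
  normalCoeff≡rooks (D ∷ w) (suc k) a       zero    a+k≡ k≡ = begin
    suc a * normalCoeff w (suc a) zero
      ≡⟨ cong (suc a *_) (normalCoeff≡rooks w k (suc a) zero a+k≡′ (suc-injective k≡)) ⟩
    suc a * rooks w k
      ≡⟨ cong (_+ suc a * rooks w k) (sym (rooks-vanish-D w (suc k) (≤-reflexive (cong suc (suc-injective (sym k≡)))))) ⟩
    rooks w (suc k) + suc a * rooks w k
      ≡⟨ sym (rooks-D′ w k a a+k≡′) ⟩
    rooks (D ∷ w) (suc k) ∎
    where
    open ≡-Reasoning
    a+k≡′ = trans (sym (+-suc a k)) a+k≡
  normalCoeff≡rooks (D ∷ w) (suc k) a       (suc b) a+k≡ b+k≡ = begin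
    normalCoeff w a b + suc a * normalCoeff w (suc a) (suc b)
      ≡⟨ cong₂ (λ x y → x + suc a * y)
               (normalCoeff≡rooks w (suc k) a b a+k≡ (suc-injective b+k≡))
               (normalCoeff≡rooks w k (suc a) (suc b) a+k≡′ (trans (sym (+-suc b k)) (suc-injective b+k≡))) ⟩
    rooks w (suc k) + suc a * rooks w k
      ≡⟨ sym (rooks-D′ w k a a+k≡′) ⟩
    rooks (D ∷ w) (suc k) ∎
    where
    open ≡-Reasoning
    a+k≡′ = trans (sym (+-suc a k)) a+k≡

  normalCoeff≡⇒rookEquivalent : ∀ u v → countU u ≡ countU v → countD u ≡ countD v →
    (∀ a b → normalCoeff u a b ≡ normalCoeff v a b) → RookEquivalent (ferrersBoard u) (ferrersBoard v)
  normalCoeff≡⇒rookEquivalent u v U≡ D≡ c≡ k = begin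
    rookNumber k (ferrersBoard u)  ≡⟨ rookNumber≡#placements k _ ⟩
    rooks u k                      ≡⟨ rooks≡ (k ≤? countU u) (k ≤? countD u) ⟩
    rooks v k                      ≡⟨ sym (rookNumber≡#placements k _) ⟩
    rookNumber k (ferrersBoard v)  ∎
    where
    open ≡-Reasoning
    rooks≡ : Dec (k ≤ countU u) → Dec (k ≤ countD u) → rooks u k ≡ rooks v k
    rooks≡ (yes k≤m) (yes k≤n) = begin
      rooks u k                                  ≡⟨ normalCoeff≡rooks u k a b a+k≡ b+k≡ ⟨
      normalCoeff u a b                          ≡⟨ c≡ a b ⟩
      normalCoeff v a b                          ≡⟨ normalCoeff≡rooks v k a b (trans a+k≡ U≡) (trans b+k≡ D≡) ⟩
      rooks v k                                  ∎
      where
      a = countU u ∸ k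
      b = countD u ∸ k
      a+k≡ = m∸n+n≡m k≤m
      b+k≡ = m∸n+n≡m k≤n
    rooks≡ (no k≰m) _ =
      trans (rooks-vanish-U u k (≰⇒> k≰m)) (sym (rooks-vanish-U v k (subst (_< k) U≡ (≰⇒> k≰m))))
    rooks≡ (yes _)  (no k≰n) =
      trans (rooks-vanish-D u k (≰⇒> k≰n)) (sym (rooks-vanish-D v k (subst (_< k) D≡ (≰⇒> k≰n))))

  rookEquivalent⇒normalCoeff≡ : ∀ u v → countU u ≡ countU v → countD u ≡ countD v →
    RookEquivalent (ferrersBoard u) (ferrersBoard v) → ∀ a b → normalCoeff u a b ≡ normalCoeff v a b
  rookEquivalent⇒normalCoeff≡ u v U≡ D≡ r≡ a b with a ≤? countU u
  ... | no a≰m =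
    trans (normalCoeff-vanish-U u a b (≰⇒> a≰m)) (sym (normalCoeff-vanish-U v a b (subst (_< a) U≡ (≰⇒> a≰m))))
  ... | yes a≤m with b + (countU u ∸ a) ≟ countD u
  ...   | yes b+k≡ = begin
    normalCoeff u a b              ≡⟨ normalCoeff≡rooks u k a b a+k≡ b+k≡ ⟩
    rooks u k                      ≡⟨ rookNumber≡#placements k _ ⟨
    rookNumber k (ferrersBoard u)  ≡⟨ r≡ k ⟩
    rookNumber k (ferrersBoard v)  ≡⟨ rookNumber≡#placements k _ ⟩
    rooks v k                      ≡⟨ normalCoeff≡rooks v k a b (trans a+k≡ U≡) (trans b+k≡ D≡) ⟨
    normalCoeff v a b              ∎
    where
    open ≡-Reasoning
    k = countU u ∸ a
    a+k≡ = m+[n∸m]≡n a≤m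
  ...   | no b+k≢ =
    trans (normalCoeff-unbalanced u a b unbalanced)
          (sym (normalCoeff-unbalanced v a b (unbalanced ∘ subst₂ (λ x y → a + x ≡ b + y) (sym D≡) (sym U≡))))
    where
    open ≡-Reasoning
    unbalanced : a + countD u ≢ b + countU u
    unbalanced e = b+k≢ (+-cancelˡ-≡ a _ _ (begin
      a + (b + (countU u ∸ a))  ≡⟨ x∙yz≈y∙xz a b (countU u ∸ a) ⟩
      b + (a + (countU u ∸ a))  ≡⟨ cong (b +_) (m+[n∸m]≡n a≤m) ⟩
      b + countU u              ≡⟨ e ⟨
      a + countD u              ∎))


module FiniteSums {a ℓ} (M : CommutativeMonoid a ℓ) where

  open import Data.Fin using (punchIn)
  open import Data.Fin.Properties using (punchInᵢ≢i)
  open import Data.Nat using (suc)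
  open import Data.Vec.Functional using (Vector; removeAt)
  open import Relation.Binary.PropositionalEquality using (_≢_)

  open CommutativeMonoid M renaming (ε to 0#)
  open import Algebra.Properties.CommutativeMonoid.Sum M using (sum; sum-cong-≋; sum-replicate-zero; sum-remove)

  sum-zero : ∀ {n} (t : Vector Carrier n) → (∀ i → t i ≈ 0#) → sum t ≈ 0#
  sum-zero {n} t t≈0 = trans (sum-cong-≋ t≈0) (sum-replicate-zero n)

  sum-single : ∀ {n} (t : Vector Carrier n) i → (∀ j → j ≢ i → t j ≈ 0#) → sum t ≈ t i
  sum-single {suc n} t i t≈0 = trans (sum-remove {i = i} t)
    (trans (∙-congˡ (sum-zero (removeAt t i) (λ j → t≈0 (punchIn i j) (punchInᵢ≢i i j)))) (identityʳ (t i)))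

module NormalOrdering {c ℓ} (K : Field c ℓ) where

  open import Level using (_⊔_)
  open import Algebra.Bundles using (Ring; Semiring)
  open import Data.Bool using (if_then_else_; true; false)
  open import Data.Empty using (⊥-elim)
  open import Data.Fin using (Fin; toℕ; fromℕ<)
  open import Data.Fin.Properties using (toℕ-injective; toℕ-fromℕ<)
  open import Data.Nat as ℕ using (ℕ; zero; suc)
  open import Data.Nat.Properties using (<-trans; n<1+n; m<n⇒m<1+n)
  open import Data.Product using (_,_)
  open import Data.Sum using (_⊎_; inj₁; inj₂)
  open import Data.List using (List; []; _∷_)
  open import Data.List.Relation.Unary.All using (All; []; _∷_)
  open import Function using (_∘_)
  open import Relation.Binary.PropositionalEquality as ≡ using (_≢_)
  open import Relation.Nullary using (does)
  open import Relation.Nullary.Decidable using (dec-true; dec-false)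
  open RookNumbers using (normalCoeff)
  import Relation.Binary.Reasoning.Setoid as SetoidReasoning

  open Field K renaming (Carrier to k; distribˡ to *-distribˡ-+; distribʳ to *-distribʳ-+) hiding (zero)
  open import Algebra.Properties.Ring ring using (-1*x≈-x)
  open import Algebra.Properties.Group +-group using (∙-cancelˡ)
  open import Algebra.Properties.CommutativeSemigroup +-commutativeSemigroup using (interchange)
  open import Algebra.Properties.CommutativeSemigroup *-commutativeSemigroup using (x∙yz≈y∙xz)
  open Weyl K

  ι : ℕ → k
  ι = natToField K

  ι-+ : ∀ m n → ι (m ℕ.+ n) ≈ ι m + ι n
  ι-+ zero    n = sym (+-identityˡ _)
  ι-+ (suc m) n = trans (+-congˡ (ι-+ m n)) (sym (+-assoc _ _ _))

  ι-* : ∀ m n → ι (m ℕ.* n) ≈ ι m * ι n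
  ι-* zero    n = sym (zeroˡ _)
  ι-* (suc m) n = begin
    ι (n ℕ.+ m ℕ.* n)     ≈⟨ ι-+ n (m ℕ.* n) ⟩
    ι n + ι (m ℕ.* n)     ≈⟨ +-cong (sym (*-identityˡ _)) (ι-* m n) ⟩
    1# * ι n + ι m * ι n  ≈⟨ *-distribʳ-+ _ _ _ ⟨
    (1# + ι m) * ι n      ∎
    where open SetoidReasoning setoid

  ι-injective : CharacteristicZero K → ∀ m n → ι m ≈ ι n → m ≡ n
  ι-injective char0 zero    zero    _ = ≡.refl
  ι-injective char0 zero    (suc n) e = ⊥-elim (char0 n (sym e))
  ι-injective char0 (suc m) zero    e = ⊥-elim (char0 m e)
  ι-injective char0 (suc m) (suc n) e = ≡.cong suc (ι-injective char0 m n (∙-cancelˡ 1# _ _ e))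

  -- f a b is the coefficient of U^a D^b; W acts on such arrays by left multiplication
  Coeffs : Set c
  Coeffs = ℕ → ℕ → k

  infix 4 _≈ₐ_
  _≈ₐ_ : Coeffs → Coeffs → Set ℓ
  f ≈ₐ g = ∀ a b → f a b ≈ g a b

  U· : Coeffs → Coeffs
  U· f zero    b = 0#
  U· f (suc a) b = f a b

  D· : Coeffs → Coeffs
  D· f a zero    = ι (suc a) * f (suc a) zero
  D· f a (suc b) = f a b + ι (suc a) * f (suc a) (suc b)

  ⟦_⟧ : Term → Coeffs → Coeffs
  ⟦ cst x ⟧ f a b = x * f a b
  ⟦ gD ⟧          = D·
  ⟦ gU ⟧          = U·
  ⟦ s ⊕ t ⟧ f a b = ⟦ s ⟧ f a b + ⟦ t ⟧ f a b
  ⟦ s ⊗ t ⟧ f     = ⟦ s ⟧ (⟦ t ⟧ f)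

  ⟦⟧-cong : ∀ s {f g} → f ≈ₐ g → ⟦ s ⟧ f ≈ₐ ⟦ s ⟧ g
  ⟦⟧-cong (cst x) f≈g a b       = *-congˡ (f≈g a b)
  ⟦⟧-cong gD      f≈g a zero    = *-congˡ (f≈g _ _)
  ⟦⟧-cong gD      f≈g a (suc b) = +-cong (f≈g _ _) (*-congˡ (f≈g _ _))
  ⟦⟧-cong gU      f≈g zero    b = refl
  ⟦⟧-cong gU      f≈g (suc a) b = f≈g a b
  ⟦⟧-cong (s ⊕ t) f≈g a b       = +-cong (⟦⟧-cong s f≈g a b) (⟦⟧-cong t f≈g a b)
  ⟦⟧-cong (s ⊗ t) f≈g           = ⟦⟧-cong s (⟦⟧-cong t f≈g)

  ⟦⟧-+ : ∀ s f g → ⟦ s ⟧ (λ a b → f a b + g a b) ≈ₐ (λ a b → ⟦ s ⟧ f a b + ⟦ s ⟧ g a b)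
  ⟦⟧-+ (cst x) f g a b       = *-distribˡ-+ x _ _
  ⟦⟧-+ gD      f g a zero    = *-distribˡ-+ _ _ _
  ⟦⟧-+ gD      f g a (suc b) = trans (+-congˡ (*-distribˡ-+ _ _ _)) (interchange _ _ _ _)
  ⟦⟧-+ gU      f g zero    b = sym (+-identityˡ 0#)
  ⟦⟧-+ gU      f g (suc a) b = refl
  ⟦⟧-+ (s ⊕ t) f g a b       = trans (+-cong (⟦⟧-+ s f g a b) (⟦⟧-+ t f g a b)) (interchange _ _ _ _)
  ⟦⟧-+ (s ⊗ t) f g a b       = trans (⟦⟧-cong s (⟦⟧-+ t f g) a b) (⟦⟧-+ s _ _ a b)

  ⟦⟧-* : ∀ s x f → ⟦ s ⟧ (λ a b → x * f a b) ≈ₐ (λ a b → x * ⟦ s ⟧ f a b)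
  ⟦⟧-* (cst y) x f a b       = x∙yz≈y∙xz y x _
  ⟦⟧-* gD      x f a zero    = x∙yz≈y∙xz _ x _
  ⟦⟧-* gD      x f a (suc b) = trans (+-congˡ (x∙yz≈y∙xz _ x _)) (sym (*-distribˡ-+ x _ _))
  ⟦⟧-* gU      x f zero    b = sym (zeroʳ x)
  ⟦⟧-* gU      x f (suc a) b = refl
  ⟦⟧-* (s ⊕ t) x f a b       = trans (+-cong (⟦⟧-* s x f a b) (⟦⟧-* t x f a b)) (sym (*-distribˡ-+ x _ _))
  ⟦⟧-* (s ⊗ t) x f a b       = trans (⟦⟧-cong s (⟦⟧-* t x f) a b) (⟦⟧-* s x _ a b)

  1+-scale : ∀ n x → (1# + n) * x ≈ n * x + 1# * x
  1+-scale n x = trans (*-distribʳ-+ x 1# n) (+-comm _ _)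

  D·U· : ∀ f → D· (U· f) ≈ₐ (λ a b → U· (D· f) a b + 1# * f a b)
  D·U· f zero    zero    = trans (*-congʳ (+-identityʳ 1#)) (sym (+-identityˡ _))
  D·U· f zero    (suc b) = +-congˡ (*-congʳ (+-identityʳ 1#))
  D·U· f (suc a) zero    = 1+-scale (ι (suc a)) _
  D·U· f (suc a) (suc b) = trans (+-congˡ (1+-scale (ι (suc a)) _)) (sym (+-assoc _ _ _))

  ⟦⟧-sound : ∀ {s t} → s ≈W t → ∀ f → ⟦ s ⟧ f ≈ₐ ⟦ t ⟧ f
  ⟦⟧-sound reflW                f a b = refl
  ⟦⟧-sound (symW e)             f a b = sym (⟦⟧-sound e f a b)
  ⟦⟧-sound (transW e e′)        f a b = trans (⟦⟧-sound e f a b) (⟦⟧-sound e′ f a b)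
  ⟦⟧-sound (⊕-cong e e′)        f a b = +-cong (⟦⟧-sound e f a b) (⟦⟧-sound e′ f a b)
  ⟦⟧-sound (⊗-cong {s} e e′)    f a b = trans (⟦⟧-cong s (⟦⟧-sound e′ f) a b) (⟦⟧-sound e _ a b)
  ⟦⟧-sound (⊕-assoc s t r)      f a b = +-assoc _ _ _
  ⟦⟧-sound (⊕-comm s t)         f a b = +-comm _ _
  ⟦⟧-sound (⊕-idˡ s)            f a b = trans (+-congʳ (zeroˡ _)) (+-identityˡ _)
  ⟦⟧-sound (⊕-invʳ s)           f a b = trans (+-congˡ (-1*x≈-x _)) (trans (-‿inverseʳ _) (sym (zeroˡ _)))
  ⟦⟧-sound (⊗-assoc s t r)      f a b = refl
  ⟦⟧-sound (⊗-idˡ s)            f a b = *-identityˡ _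
  ⟦⟧-sound (⊗-idʳ s)            f a b = ⟦⟧-cong s (λ a b → *-identityˡ _) a b
  ⟦⟧-sound (distribˡ s t r)     f a b = ⟦⟧-+ s _ _ a b
  ⟦⟧-sound (distribʳ s t r)     f a b = refl
  ⟦⟧-sound (cst-cong x≈y)       f a b = *-congʳ x≈y
  ⟦⟧-sound (cst-+ x y)          f a b = *-distribʳ-+ _ x y
  ⟦⟧-sound (cst-* x y)          f a b = *-assoc x y _
  ⟦⟧-sound (cst-central x s)    f a b = sym (⟦⟧-* s x f a b)
  ⟦⟧-sound weyl                 f a b = D·U· f a b

  δ : ℕ → ℕ → Coeffs
  δ a₀ b₀ a b = if does (a₀ ℕ.≟ a) then (if does (b₀ ℕ.≟ b) then 1# else 0#) else 0#

  ⟦φ⟧ : ∀ w → ⟦ φ w ⟧ (δ 0 0) ≈ₐ (λ a b → ι (normalCoeff w a b))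
  ⟦φ⟧ []      zero    zero    = trans (*-identityˡ 1#) (sym (+-identityʳ 1#))
  ⟦φ⟧ []      zero    (suc b) = zeroʳ 1#
  ⟦φ⟧ []      (suc a) b       = zeroʳ 1#
  ⟦φ⟧ (U ∷ w) zero    b       = refl
  ⟦φ⟧ (U ∷ w) (suc a) b       = ⟦φ⟧ w a b
  ⟦φ⟧ (D ∷ w) a       zero    =
    trans (*-congˡ (⟦φ⟧ w (suc a) zero)) (sym (ι-* (suc a) (normalCoeff w (suc a) zero)))
  ⟦φ⟧ (D ∷ w) a       (suc b) = trans (+-cong (⟦φ⟧ w a b) (*-congˡ (⟦φ⟧ w (suc a) (suc b))))
    (sym (trans (ι-+ (normalCoeff w a b) _) (+-congˡ (ι-* (suc a) (normalCoeff w (suc a) (suc b))))))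

  φ≈⇒normalCoeff≡ : CharacteristicZero K → ∀ {u v} → φ u ≈W φ v → ∀ a b → normalCoeff u a b ≡ normalCoeff v a b
  φ≈⇒normalCoeff≡ char0 {u} {v} φu≈φv a b =
    ι-injective char0 _ _ (trans (sym (⟦φ⟧ u a b)) (trans (⟦⟧-sound φu≈φv (δ 0 0) a b) (⟦φ⟧ v a b)))

  weylRing : Ring c (c ⊔ ℓ)
  weylRing = record
    { Carrier = Term
    ; _≈_     = _≈W_
    ; _+_     = _⊕_
    ; _*_     = _⊗_
    ; -_      = cst (- 1#) ⊗_
    ; 0#      = cst 0#
    ; 1#      = cst 1#
    ; isRing  = record
      { +-isAbelianGroup = record
        { isGroup = record
          { isMonoid = record
            { isSemigroup = record
              { isMagma = record
                { isEquivalence = record { refl = reflW ; sym = symW ; trans = transW }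
                ; ∙-cong = ⊕-cong }
              ; assoc = ⊕-assoc }
            ; identity = ⊕-idˡ , λ s → transW (⊕-comm s _) (⊕-idˡ s) }
          ; inverse = (λ s → transW (⊕-comm _ s) (⊕-invʳ s)) , ⊕-invʳ
          ; ⁻¹-cong = ⊗-cong reflW }
        ; comm = ⊕-comm }
      ; *-cong     = ⊗-cong
      ; *-assoc    = ⊗-assoc
      ; *-identity = ⊗-idˡ , ⊗-idʳ
      ; distrib    = distribˡ , distribʳ } }

  module W = Ring weylRing
  module ≈W-Reasoning = SetoidReasoning W.setoid
  open FiniteSums W.+-commutativeMonoid using (sum-zero; sum-single)
  open import Algebra.Definitions.RawSemiring (Semiring.rawSemiring W.semiring) using (_^_)

  monomial : ℕ → ℕ → Term
  monomial a b = gU ^ a ⊗ gD ^ b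

  cst-comm : ∀ t x s → t ⊗ (cst x ⊗ s) ≈W cst x ⊗ (t ⊗ s)
  cst-comm t x s =
    W.trans (W.sym (W.*-assoc _ _ _)) (W.trans (W.*-congʳ (W.sym (cst-central x t))) (W.*-assoc _ _ _))

  D⊗U^suc : ∀ a → gD ⊗ gU ^ suc a ≈W gU ^ suc a ⊗ gD ⊕ cst (ι (suc a)) ⊗ gU ^ a
  D⊗U^suc zero = begin
    gD ⊗ (gU ⊗ cst 1#)                            ≈⟨ W.*-assoc _ _ _ ⟨
    (gD ⊗ gU) ⊗ cst 1#                            ≈⟨ W.*-identityʳ _ ⟩
    gD ⊗ gU                                       ≈⟨ weyl ⟩
    gU ⊗ gD ⊕ cst 1#                              ≈⟨ W.+-cong (W.*-congʳ (W.*-identityʳ gU)) (W.*-identityʳ _) ⟨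
    (gU ⊗ cst 1#) ⊗ gD ⊕ cst 1# ⊗ cst 1#          ≈⟨ W.+-congˡ (W.*-congʳ (cst-cong (+-identityʳ 1#))) ⟨
    (gU ⊗ cst 1#) ⊗ gD ⊕ cst (1# + 0#) ⊗ cst 1#   ∎
    where open ≈W-Reasoning
  D⊗U^suc (suc a) = begin
    gD ⊗ (gU ⊗ P)                                 ≈⟨ W.*-assoc _ _ _ ⟨
    (gD ⊗ gU) ⊗ P                                 ≈⟨ W.*-congʳ weyl ⟩
    (gU ⊗ gD ⊕ cst 1#) ⊗ P                        ≈⟨ W.distribʳ _ _ _ ⟩
    (gU ⊗ gD) ⊗ P ⊕ cst 1# ⊗ P                    ≈⟨ W.+-congʳ (W.*-assoc _ _ _) ⟩
    gU ⊗ (gD ⊗ P) ⊕ cst 1# ⊗ P                    ≈⟨ W.+-congʳ (W.*-congˡ (D⊗U^suc a)) ⟩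
    gU ⊗ (P ⊗ gD ⊕ cst n ⊗ gU ^ a) ⊕ cst 1# ⊗ P   ≈⟨ W.+-congʳ (W.distribˡ _ _ _) ⟩
    (gU ⊗ (P ⊗ gD) ⊕ gU ⊗ (cst n ⊗ gU ^ a)) ⊕ cst 1# ⊗ P
                                                  ≈⟨ W.+-congʳ (W.+-cong (W.sym (W.*-assoc _ _ _)) (cst-comm gU n _)) ⟩
    ((gU ⊗ P) ⊗ gD ⊕ cst n ⊗ P) ⊕ cst 1# ⊗ P      ≈⟨ W.+-assoc _ _ _ ⟩
    (gU ⊗ P) ⊗ gD ⊕ (cst n ⊗ P ⊕ cst 1# ⊗ P)      ≈⟨ W.+-congˡ (W.distribʳ _ _ _) ⟨
    (gU ⊗ P) ⊗ gD ⊕ (cst n ⊕ cst 1#) ⊗ P          ≈⟨ W.+-congˡ (W.*-congʳ (cst-+ n 1#)) ⟨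
    (gU ⊗ P) ⊗ gD ⊕ cst (n + 1#) ⊗ P              ≈⟨ W.+-congˡ (W.*-congʳ (cst-cong (+-comm n 1#))) ⟩
    (gU ⊗ P) ⊗ gD ⊕ cst (1# + n) ⊗ P              ∎
    where
    open ≈W-Reasoning
    P = gU ^ suc a
    n = ι (suc a)

  U⊗monomial : ∀ a b → gU ⊗ monomial a b ≈W monomial (suc a) b
  U⊗monomial a b = W.sym (W.*-assoc _ _ _)

  D⊗monomial-zero : ∀ b → gD ⊗ monomial 0 b ≈W monomial 0 (suc b)
  D⊗monomial-zero b = cst-comm gD 1# _

  D⊗monomial-suc : ∀ a b → gD ⊗ monomial (suc a) b ≈W monomial (suc a) (suc b) ⊕ cst (ι (suc a)) ⊗ monomial a b
  D⊗monomial-suc a b = begin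
    gD ⊗ (gU ^ suc a ⊗ gD ^ b)                                ≈⟨ W.*-assoc _ _ _ ⟨
    (gD ⊗ gU ^ suc a) ⊗ gD ^ b                                ≈⟨ W.*-congʳ (D⊗U^suc a) ⟩
    (gU ^ suc a ⊗ gD ⊕ cst (ι (suc a)) ⊗ gU ^ a) ⊗ gD ^ b     ≈⟨ W.distribʳ _ _ _ ⟩
    (gU ^ suc a ⊗ gD) ⊗ gD ^ b ⊕ (cst (ι (suc a)) ⊗ gU ^ a) ⊗ gD ^ b
                                                              ≈⟨ W.+-cong (W.*-assoc _ _ _) (W.*-assoc _ _ _) ⟩
    monomial (suc a) (suc b) ⊕ cst (ι (suc a)) ⊗ monomial a b ∎
    where open ≈W-Reasoning

  Monomial : Set c
  Monomial = k × ℕ × ℕ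

  ∑ₘ : List Monomial → Term
  ∑ₘ []                = cst 0#
  ∑ₘ ((x , a , b) ∷ N) = cst x ⊗ monomial a b ⊕ ∑ₘ N

  mulU mulD : List Monomial → List Monomial
  mulU []                = []
  mulU ((x , a , b) ∷ N) = (x , suc a , b) ∷ mulU N
  mulD []                      = []
  mulD ((x , zero , b) ∷ N)    = (x , zero , suc b) ∷ mulD N
  mulD ((x , suc a , b) ∷ N)   = (x , suc a , suc b) ∷ (x * ι (suc a) , a , b) ∷ mulD N

  gU⊗∑ₘ : ∀ N → gU ⊗ ∑ₘ N ≈W ∑ₘ (mulU N)
  gU⊗∑ₘ []                = W.zeroʳ gU
  gU⊗∑ₘ ((x , a , b) ∷ N) =
    W.trans (W.distribˡ _ _ _)
            (W.+-cong (W.trans (cst-comm gU x _) (W.*-congˡ (U⊗monomial a b))) (gU⊗∑ₘ N))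

  gD⊗∑ₘ : ∀ N → gD ⊗ ∑ₘ N ≈W ∑ₘ (mulD N)
  gD⊗∑ₘ []                    = W.zeroʳ gD
  gD⊗∑ₘ ((x , zero , b) ∷ N)  =
    W.trans (W.distribˡ _ _ _)
            (W.+-cong (W.trans (cst-comm gD x _) (W.*-congˡ (D⊗monomial-zero b))) (gD⊗∑ₘ N))
  gD⊗∑ₘ ((x , suc a , b) ∷ N) = begin
    gD ⊗ (cst x ⊗ monomial (suc a) b ⊕ ∑ₘ N)
      ≈⟨ W.distribˡ _ _ _ ⟩
    gD ⊗ (cst x ⊗ monomial (suc a) b) ⊕ gD ⊗ ∑ₘ N
      ≈⟨ W.+-cong (W.trans (cst-comm gD x _) (W.*-congˡ (D⊗monomial-suc a b))) (gD⊗∑ₘ N) ⟩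
    cst x ⊗ (monomial (suc a) (suc b) ⊕ cst (ι (suc a)) ⊗ monomial a b) ⊕ ∑ₘ (mulD N)
      ≈⟨ W.+-congʳ (W.trans (W.distribˡ _ _ _) (W.+-congˡ (W.sym (W.*-assoc _ _ _)))) ⟩
    (cst x ⊗ monomial (suc a) (suc b) ⊕ (cst x ⊗ cst (ι (suc a))) ⊗ monomial a b) ⊕ ∑ₘ (mulD N)
      ≈⟨ W.+-congʳ (W.+-congˡ (W.*-congʳ (cst-* x _))) ⟨
    (cst x ⊗ monomial (suc a) (suc b) ⊕ cst (x * ι (suc a)) ⊗ monomial a b) ⊕ ∑ₘ (mulD N)
      ≈⟨ W.+-assoc _ _ _ ⟩
    ∑ₘ (mulD ((x , suc a , b) ∷ N)) ∎
    where open ≈W-Reasoning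

  normalForm : Word → List Monomial
  normalForm []      = (1# , 0 , 0) ∷ []
  normalForm (D ∷ w) = mulD (normalForm w)
  normalForm (U ∷ w) = mulU (normalForm w)

  φ≈normalForm : ∀ w → φ w ≈W ∑ₘ (normalForm w)
  φ≈normalForm []      = W.sym (W.trans (W.+-identityʳ _) (W.trans (W.*-identityˡ _) (W.*-identityˡ _)))
  φ≈normalForm (D ∷ w) = W.trans (W.*-congˡ (φ≈normalForm w)) (gD⊗∑ₘ (normalForm w))
  φ≈normalForm (U ∷ w) = W.trans (W.*-congˡ (φ≈normalForm w)) (gU⊗∑ₘ (normalForm w))

  open import Algebra.Properties.CommutativeMonoid.Sum W.+-commutativeMonoid
    using (sum-syntax; sum-cong-≋; ∑-distrib-+)

  grid : ℕ → ℕ → Coeffs → Term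
  grid A B f = ∑[ i < A ] ∑[ j < B ] (cst (f (toℕ i) (toℕ j)) ⊗ monomial (toℕ i) (toℕ j))

  grid-cong : ∀ A B {f g} → f ≈ₐ g → grid A B f ≈W grid A B g
  grid-cong A B f≈g = sum-cong-≋ {A} λ i → sum-cong-≋ {B} λ j → W.*-congʳ (cst-cong (f≈g (toℕ i) (toℕ j)))

  grid-+ : ∀ A B f g → grid A B f ⊕ grid A B g ≈W grid A B (λ a b → f a b + g a b)
  grid-+ A B f g = W.sym (W.trans
    (sum-cong-≋ {A} λ i → W.trans (sum-cong-≋ {B} λ j → split i j) (∑-distrib-+ {B} _ _))
    (∑-distrib-+ {A} _ _))
    where
    split : ∀ (i : Fin A) (j : Fin B) → let a = toℕ i ; b = toℕ j in
      cst (f a b + g a b) ⊗ monomial a b ≈W cst (f a b) ⊗ monomial a b ⊕ cst (g a b) ⊗ monomial a b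
    split i j = W.trans (W.*-congʳ (cst-+ _ _)) (W.distribʳ _ _ _)

  δ-diag : ∀ a b → δ a b a b ≡ 1#
  δ-diag a b rewrite dec-true (a ℕ.≟ a) ≡.refl | dec-true (b ℕ.≟ b) ≡.refl = ≡.refl

  δ-off : ∀ a₀ b₀ a b → a ≢ a₀ ⊎ b ≢ b₀ → δ a₀ b₀ a b ≡ 0#
  δ-off a₀ b₀ a b (inj₁ a≢a₀) rewrite dec-false (a₀ ℕ.≟ a) (a≢a₀ ∘ ≡.sym) = ≡.refl
  δ-off a₀ b₀ a b (inj₂ b≢b₀) with does (a₀ ℕ.≟ a)
  ... | false = ≡.refl
  ... | true rewrite dec-false (b₀ ℕ.≟ b) (b≢b₀ ∘ ≡.sym) = ≡.refl

  grid-δ : ∀ {A B a b} x → a ℕ.< A → b ℕ.< B → grid A B (λ a′ b′ → x * δ a b a′ b′) ≈W cst x ⊗ monomial a b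
  grid-δ {A} {B} x a<A b<B =
    ≡.subst₂ (λ a b → grid A B (λ a′ b′ → x * δ a b a′ b′) ≈W cst x ⊗ monomial a b)
             (toℕ-fromℕ< a<A) (toℕ-fromℕ< b<B) (grid-single (fromℕ< a<A) (fromℕ< b<B))
    where
    term-vanishes : ∀ a₀ b₀ a b → a ≢ a₀ ⊎ b ≢ b₀ → cst (x * δ a₀ b₀ a b) ⊗ monomial a b ≈W cst 0#
    term-vanishes a₀ b₀ a b a,b≢ =
      W.trans (W.*-congʳ (cst-cong (trans (*-congˡ (reflexive (δ-off a₀ b₀ a b a,b≢))) (zeroʳ x)))) (W.zeroˡ _)
    grid-single : ∀ (i₀ : Fin A) (j₀ : Fin B) → let a₀ = toℕ i₀ ; b₀ = toℕ j₀ in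
      grid A B (λ a′ b′ → x * δ a₀ b₀ a′ b′) ≈W cst x ⊗ monomial a₀ b₀
    grid-single i₀ j₀ = begin
      grid A B (λ a′ b′ → x * δ a₀ b₀ a′ b′)
        ≈⟨ sum-single {A} _ i₀ (λ i i≢i₀ → sum-zero {B} _ λ j →
             term-vanishes a₀ b₀ (toℕ i) (toℕ j) (inj₁ (i≢i₀ ∘ toℕ-injective))) ⟩
      ∑[ j < B ] (cst (x * δ a₀ b₀ a₀ (toℕ j)) ⊗ monomial a₀ (toℕ j))
        ≈⟨ sum-single {B} _ j₀ (λ j j≢j₀ → term-vanishes a₀ b₀ a₀ (toℕ j) (inj₂ (j≢j₀ ∘ toℕ-injective))) ⟩
      cst (x * δ a₀ b₀ a₀ b₀) ⊗ monomial a₀ b₀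
        ≈⟨ W.*-congʳ (cst-cong (trans (*-congˡ (reflexive (δ-diag a₀ b₀))) (*-identityʳ x))) ⟩
      cst x ⊗ monomial a₀ b₀ ∎
      where
      open ≈W-Reasoning
      a₀ = toℕ i₀
      b₀ = toℕ j₀

  coeffs : List Monomial → Coeffs
  coeffs []                  a b = 0#
  coeffs ((x , a₀ , b₀) ∷ N) a b = x * δ a₀ b₀ a b + coeffs N a b

  Bounded : ℕ → ℕ → List Monomial → Set c
  Bounded A B = All (λ (_ , a , b) → a ℕ.< A × b ℕ.< B)

  mulU-bounded : ∀ {A B} N → Bounded A B N → Bounded (suc A) B (mulU N)
  mulU-bounded []      []                   = []
  mulU-bounded (_ ∷ N) ((a<A , b<B) ∷ bnd) = (ℕ.s≤s a<A , b<B) ∷ mulU-bounded N bnd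

  mulD-bounded : ∀ {A B} N → Bounded A B N → Bounded A (suc B) (mulD N)
  mulD-bounded []                  []                   = []
  mulD-bounded ((_ , zero , _) ∷ N)  ((a<A , b<B) ∷ bnd) = (a<A , ℕ.s≤s b<B) ∷ mulD-bounded N bnd
  mulD-bounded ((_ , suc a , _) ∷ N) ((a<A , b<B) ∷ bnd) =
    (a<A , ℕ.s≤s b<B) ∷ (<-trans (n<1+n a) a<A , m<n⇒m<1+n b<B) ∷ mulD-bounded N bnd

  normalForm-bounded : ∀ w → Bounded (suc (countU w)) (suc (countD w)) (normalForm w)
  normalForm-bounded []      = (ℕ.s≤s ℕ.z≤n , ℕ.s≤s ℕ.z≤n) ∷ []
  normalForm-bounded (D ∷ w) = mulD-bounded (normalForm w) (normalForm-bounded w)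
  normalForm-bounded (U ∷ w) = mulU-bounded (normalForm w) (normalForm-bounded w)

  ∑ₘ≈grid : ∀ {A B} N → Bounded A B N → ∑ₘ N ≈W grid A B (coeffs N)
  ∑ₘ≈grid {A} {B} [] [] =
    W.sym (sum-zero {A} _ λ _ → sum-zero {B} _ λ _ → W.zeroˡ _)
  ∑ₘ≈grid {A} {B} ((x , a , b) ∷ N) ((a<A , b<B) ∷ bnd) =
    W.trans (W.+-cong (W.sym (grid-δ x a<A b<B)) (∑ₘ≈grid N bnd))
            (grid-+ A B (λ a′ b′ → x * δ a b a′ b′) (coeffs N))

  ⟦gD^⟧ : ∀ b → ⟦ gD ^ b ⟧ (δ 0 0) ≈ₐ δ 0 b
  ⟦gD^⟧ zero    a b = *-identityˡ _
  ⟦gD^⟧ (suc b) a b′ = trans (⟦⟧-cong gD (⟦gD^⟧ b) a b′) (D·δ a b′)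
    where
    D·δ : D· (δ 0 b) ≈ₐ δ 0 (suc b)
    D·δ zero    zero     = zeroʳ _
    D·δ (suc a) zero     = zeroʳ _
    D·δ a       (suc b′) = trans (+-congˡ (zeroʳ _)) (+-identityʳ _)

  ⟦gU^⟧ : ∀ a b → ⟦ gU ^ a ⟧ (δ 0 b) ≈ₐ δ a b
  ⟦gU^⟧ zero    b a′ b′       = *-identityˡ _
  ⟦gU^⟧ (suc a) b zero    b′ = refl
  ⟦gU^⟧ (suc a) b (suc a′) b′ = ⟦gU^⟧ a b a′ b′

  ⟦∑ₘ⟧ : ∀ N → ⟦ ∑ₘ N ⟧ (δ 0 0) ≈ₐ coeffs N
  ⟦∑ₘ⟧ []                a′ b′ = zeroˡ _
  ⟦∑ₘ⟧ ((x , a , b) ∷ N) a′ b′ =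
    +-cong (*-congˡ (trans (⟦⟧-cong (gU ^ a) (⟦gD^⟧ b) a′ b′) (⟦gU^⟧ a b a′ b′))) (⟦∑ₘ⟧ N a′ b′)

  coeffs-normalForm : ∀ w → coeffs (normalForm w) ≈ₐ (λ a b → ι (normalCoeff w a b))
  coeffs-normalForm w a b =
    trans (sym (⟦∑ₘ⟧ (normalForm w) a b)) (trans (⟦⟧-sound (W.sym (φ≈normalForm w)) (δ 0 0) a b) (⟦φ⟧ w a b))

  φ≈grid : ∀ w → φ w ≈W grid (suc (countU w)) (suc (countD w)) (λ a b → ι (normalCoeff w a b))
  φ≈grid w = begin
    φ w                                                ≈⟨ φ≈normalForm w ⟩
    ∑ₘ (normalForm w)                                  ≈⟨ ∑ₘ≈grid (normalForm w) (normalForm-bounded w) ⟩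
    grid (suc (countU w)) (suc (countD w)) (coeffs (normalForm w))
                                                       ≈⟨ grid-cong (suc (countU w)) (suc (countD w)) (coeffs-normalForm w) ⟩
    grid (suc (countU w)) (suc (countD w)) (λ a b → ι (normalCoeff w a b)) ∎
    where open ≈W-Reasoning

  normalCoeff≡⇒φ≈ : ∀ {u v} → countU u ≡ countU v → countD u ≡ countD v →
    (∀ a b → normalCoeff u a b ≡ normalCoeff v a b) → φ u ≈W φ v
  normalCoeff≡⇒φ≈ {u} {v} U≡ D≡ c≡ = begin
    φ u                              ≈⟨ φ≈grid u ⟩
    grid A B (λ a b → ι (normalCoeff u a b))
                                     ≈⟨ grid-cong A B (λ a b → reflexive (≡.cong ι (c≡ a b))) ⟩
    grid A B (λ a b → ι (normalCoeff v a b))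
                                     ≡⟨ ≡.cong₂ (λ m n → grid (suc m) (suc n) (λ a b → ι (normalCoeff v a b))) U≡ D≡ ⟩
    grid (suc (countU v)) (suc (countD v)) (λ a b → ι (normalCoeff v a b))
                                     ≈⟨ φ≈grid v ⟨
    φ v                              ∎
    where
    open ≈W-Reasoning
    A = suc (countU u)
    B = suc (countD u)

open RookNumbers using (normalCoeff≡⇒rookEquivalent; rookEquivalent⇒normalCoeff≡)
open NormalOrdering using (φ≈⇒normalCoeff≡; normalCoeff≡⇒φ≈)

theorem8p2 : ∀ {c ℓ : Level} (K : Field c ℓ) → CharacteristicZero K →
    (u v : Word) → countD u ≡ countD v → countU u ≡ countU v →
    (Weyl._≈W_ K (Weyl.φ K u) (Weyl.φ K v) ⇔ RookEquivalent (ferrersBoard u) (ferrersBoard v))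
theorem8p2 K char0 u v D≡ U≡ = mk⇔
  (λ φu≈φv → normalCoeff≡⇒rookEquivalent u v U≡ D≡ (φ≈⇒normalCoeff≡ K char0 φu≈φv))
  (λ rook≡ → normalCoeff≡⇒φ≈ K U≡ D≡ (rookEquivalent⇒normalCoeff≡ u v U≡ D≡ rook≡))
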